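{- If every function $f:\mathbb R\to\mathbb R$ that is non-discontinuous at $0$ is continuous at $0$, then Markov's principle holds.
   Context: Work constructively; $\tilde\exists x.A$ abbreviates $\neg\forall x.\neg A$. Markov's principle: for every decidable predicate $P$ on $\mathbb N$, $\neg\neg\exists n.\,P(n)$ implies $\exists n.\,P(n)$. $\mathsf{I}\mathbb{Q}=\{[p,q]\mid p\le q\in\mathbb Q\}$ ordered by $[p,q]\sqsubseteq[p',q']$ iff $p\le p'\le q'\le q$; $\ell([p,q])=q-p$. $\beta\ll\gamma$ means: for every chain $(x_n)$ whose supremum exists and satisfies $\gamma\sqsubseteq\bigsqcup_n x_n$, there weakly exists $n$ with $\beta\sqsubseteq x_n$. $\mathsf{I}\mathbb{R}$ is the set of increasing sequences $x=([\underline x_n,\overline x_n])_n$ in $\mathsf{I}\mathbb{Q}$, preordered by $(x_n)\sqsubseteq(y_n)$ iff for all $b\in\mathsf{I}\mathbb{Q}$, $n$, $b\ll x_n$ implies $\tilde\exists m.\,b\ll y_m$; equality is mutual $\sqsubseteq$. $\mathbb R$ is the set of total reals $x\in\mathsf{I}\mathbb{R}$, i.e. with $\forall k.\,\tilde\exists n.\,\ell(x_n)\le2^{ -k}$. Arithmetic: $a+b=[\underline a+\underline b,\overline a+\overline b]$, $-a=[-\overline a,-\underline a]$, $|a|=a$ if $0\le\underline a$, $[0,\max\{ -\underline a,\overline a\}]$ if $\underline a\le0\le\overline a$, $-a$ if $\overline a\le0$, extended pointwise, $x-y=x+(-y)$, rationals identified with $([q,q])_n$; $0\le x$ iff $\forall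 k.\,\tilde\exists n.\,-2^{ -k}\le\underline x_n$; $x\le y$ iff $0\le y-x$. A classical null sequence is a decreasing sequence $(q_n)$ in $\mathbb Q_{\ge0}\cup\{\infty\}$ with $\forall\epsilon>0.\,\tilde\exists m.\,\forall n\ge m.\,q_n\le\epsilon$. $f$ is non-discontinuous at $x$ if there is a sequence $(\delta_n,\epsilon_n)_n$ in $\mathbb Q_{>0}\times(\mathbb Q_{\ge0}\cup\{\infty\})$ such that for all $n$ and $y\in\mathbb R$, $|x-y|\le\delta_n$ implies $|f(x)-f(y)|\le\epsilon_n$, and $(\epsilon_n)$ is a classical null sequence. $f$ is continuous at $x$ if for every $\epsilon\in\mathbb Q_{>0}$ there exists $\delta\in\mathbb Q_{>0}$ with $|f(x)-f(y)|\le\epsilon$ for all $y\in\mathbb R$ with $|x-y|\le\delta$. -}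

module Defs where

open import Data.Nat as ℕ using (ℕ; zero; suc)
open import Data.Rational
  using (ℚ; 0ℚ; 1ℚ; ½; _+_; _*_; -_; _-_; _⊔_; _≤_; _<_; _≤?_; NonNegative)
open import Data.Rational.Properties
  using (≤-refl; ≤-trans; +-mono-≤; neg-antimono-≤; p≤q⊔p; ≰⇒>; <⇒≤
        ; nonNeg*nonNeg⇒nonNeg; nonNegative⁻¹)
open import Data.Product using (Σ; ∃; _×_; _,_)
open import Data.Unit using (⊤)
open import Data.Empty using (⊥)
open import Relation.Nullary using (¬_; Dec; yes; no)
open import Relation.Binary.PropositionalEquality using (_≡_)

∃̃ : {A : Set} → (A → Set) → Set
∃̃ {A} P = ¬ ((x : A) → ¬ P x)

MarkovPrinciple : Set₁
MarkovPrinciple =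
  (P : ℕ → Set) → ((n : ℕ) → Dec (P n)) → ¬ ¬ (∃ λ n → P n) → ∃ λ n → P n

2^-_ : ℕ → ℚ
2^- zero    = 1ℚ
2^- (suc k) = ½ * (2^- k)

record IQ : Set where
  constructor [_,_]⟨_⟩
  field
    lo  : ℚ
    hi  : ℚ
    lo≤hi : lo ≤ hi
open IQ public

_⊑_ : IQ → IQ → Set
a ⊑ b = (lo a ≤ lo b) × (hi b ≤ hi a)

ℓ : IQ → ℚ
ℓ a = hi a - lo a

⟦_⟧ : ℚ → IQ
⟦ q ⟧ = [ q , q ]⟨ ≤-refl ⟩

_⊕_ : IQ → IQ → IQ
a ⊕ b = [ lo a + lo b , hi a + hi b ]⟨ +-mono-≤ (lo≤hi a) (lo≤hi b) ⟩

⊖_ : IQ → IQ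
⊖ a = [ - hi a , - lo a ]⟨ neg-antimono-≤ (lo≤hi a) ⟩

-- |a| = a if 0 ≤ lo a;  -a if hi a ≤ 0;  [0, max(-lo a, hi a)] otherwise
-- (the cases of the paper agree on their overlaps)
absI : IQ → IQ
absI a with 0ℚ ≤? lo a
... | yes _ = a
... | no _ with hi a ≤? 0ℚ
...   | yes _ = ⊖ a
...   | no h  = [ 0ℚ , (- lo a) ⊔ hi a ]⟨ ≤-trans (<⇒≤ (≰⇒> h)) (p≤q⊔p (- lo a) (hi a)) ⟩

Seq : Set
Seq = ℕ → IQ

IsChain : Seq → Set
IsChain x = (n : ℕ) → x n ⊑ x (suc n)

IsSup : Seq → IQ → Set
IsSup x s = ((n : ℕ) → x n ⊑ s) × ((u : IQ) → ((n : ℕ) → x n ⊑ u) → s ⊑ u)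

_≪_ : IQ → IQ → Set
β ≪ γ = (x : Seq) → IsChain x → (s : IQ) → IsSup x s → γ ⊑ s →
        ∃̃ λ (n : ℕ) → β ⊑ x n

record IR : Set where
  field
    seq   : Seq
    chain : IsChain seq
open IR public

_⊑ᴵᴿ_ : IR → IR → Set
x ⊑ᴵᴿ y = (b : IQ) (n : ℕ) → b ≪ seq x n → ∃̃ λ (m : ℕ) → b ≪ seq y m

_≈ᴵᴿ_ : IR → IR → Set
x ≈ᴵᴿ y = (x ⊑ᴵᴿ y) × (y ⊑ᴵᴿ x)

IsTotal : IR → Set
IsTotal x = (k : ℕ) → ∃̃ λ (n : ℕ) → ℓ (seq x n) ≤ 2^- k

record ℝ : Set where
  field
    ir    : IR
    total : IsTotal ir
open ℝ public

_≈_ : ℝ → ℝ → Set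
x ≈ y = ir x ≈ᴵᴿ ir y

-- Pointwise arithmetic on sequences (only raw sequences are needed
-- to state the order relations below)

_+ˢ_ : Seq → Seq → Seq
(x +ˢ y) n = x n ⊕ y n

-ˢ_ : Seq → Seq
(-ˢ x) n = ⊖ x n

_-ˢ_ : Seq → Seq → Seq
x -ˢ y = x +ˢ (-ˢ y)

∣_∣ˢ : Seq → Seq
∣ x ∣ˢ n = absI (x n)

ratˢ : ℚ → Seq
ratˢ q _ = ⟦ q ⟧

0≤ˢ_ : Seq → Set
0≤ˢ x = (k : ℕ) → ∃̃ λ (n : ℕ) → - (2^- k) ≤ lo (x n)

_≤ˢ_ : Seq → Seq → Set
x ≤ˢ y = 0≤ˢ (y -ˢ x)

dist≤ : ℝ → ℝ → ℚ → Set
dist≤ x y q = ∣ seq (ir x) -ˢ seq (ir y) ∣ˢ ≤ˢ ratˢ q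

2^-nonNeg : (k : ℕ) → NonNegative (2^- k)
2^-nonNeg zero    = _
2^-nonNeg (suc k) = nonNeg*nonNeg⇒nonNeg ½ (2^- k) {{2^-nonNeg k}}

0ℝ : ℝ
0ℝ = record
  { ir    = record { seq = ratˢ 0ℚ ; chain = λ _ → ≤-refl , ≤-refl }
  ; total = λ k h → h 0 (nonNegative⁻¹ (2^- k) {{2^-nonNeg k}}) }

data ℚ∞ : Set where
  fin : ℚ → ℚ∞
  ∞   : ℚ∞

_≤∞_ : ℚ∞ → ℚ∞ → Set
fin p ≤∞ fin q = p ≤ q
_     ≤∞ ∞     = ⊤
∞     ≤∞ fin _ = ⊥

NonNeg∞ : ℚ∞ → Set
NonNeg∞ (fin q) = 0ℚ ≤ q
NonNeg∞ ∞       = ⊤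

IsClassicalNullSeq : (ℕ → ℚ∞) → Set
IsClassicalNullSeq q =
  ((n : ℕ) → NonNeg∞ (q n)) ×
  ((n : ℕ) → q (suc n) ≤∞ q n) ×
  ((ε : ℚ) → 0ℚ < ε →
     ∃̃ λ (m : ℕ) → (n : ℕ) → m ℕ.≤ n → q n ≤∞ fin ε)

dist≤∞ : ℝ → ℝ → ℚ∞ → Set
dist≤∞ x y (fin e) = dist≤ x y e
dist≤∞ x y ∞       = ⊤

Respects≈ : (ℝ → ℝ) → Set
Respects≈ f = (x y : ℝ) → x ≈ y → f x ≈ f y

NonDiscontinuousAt : (ℝ → ℝ) → ℝ → Set
NonDiscontinuousAt f x =
  Σ (ℕ → ℚ) λ δ → Σ (ℕ → ℚ∞) λ ε →
    ((n : ℕ) → 0ℚ < δ n) ×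
    ((n : ℕ) (y : ℝ) → dist≤ x y (δ n) → dist≤∞ (f x) (f y) (ε n)) ×
    IsClassicalNullSeq ε

ContinuousAt : (ℝ → ℝ) → ℝ → Set
ContinuousAt f x =
  (ε : ℚ) → 0ℚ < ε → Σ ℚ λ δ → (0ℚ < δ) ×
    ((y : ℝ) → dist≤ x y δ → dist≤ (f x) (f y) ε)

module Submission where

-- Let P be decidable with ¬¬∃n.P n, and let k be its least witness.  The
-- counterexample is F(y) = clamp(2^k · y), where clamp cuts off at ±1.
-- F is computable without knowing k: its n-th approximating interval is
-- [-1,1] while no witness ≤ n has been found, and the interval image of
-- y's n-th interval under u ↦ clamp(2^k · u) once the least witness k ≤ n
-- is known.  These stages form a chain; they shrink (F(y) is total)
-- because ¬¬∃ weakly guarantees that the witness is found; and F respects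
-- equality of reals because the interval image of a monotone Lipschitz map
-- interpolates the way-below relation, which on rational intervals is
-- strict containment.  F is non-discontinuous at 0 with δₙ = 2^-n and
-- εₙ = ∞ before the witness is found, εₙ = 2^k·2^-n afterwards.  If F is
-- continuous at 0, take δ for ε = ½ and N with 2^-N ≤ δ: the search up to
-- N must succeed, for otherwise the least witness j > N gives
-- |F(0) - F(2^-j)| = clamp(1) = 1 > ½.

open import Defs
open import Data.Nat as ℕ using (ℕ; zero; suc)
import Data.Nat.Properties as ℕP
open import Data.Integer as ℤ using (+_; +[1+_])
import Data.Integer.Properties as ℤP
open import Data.Rational
  using (ℚ; mkℚ; 0ℚ; 1ℚ; ½; _+_; _*_; -_; _-_; _⊔_; _⊓_; _≤_; _<_; _≤?_; _<?_
        ; *<*; toℚᵘ; positive; nonNegative)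
open import Data.Rational.Properties
open import Data.Rational.Unnormalised as U using (mkℚᵘ)
import Data.Rational.Unnormalised.Properties as UP
open import Data.Rational.Solver using (module +-*-Solver)
open +-*-Solver using (solve; _:+_; _:*_; :-_; _:-_; _:=_; con)
open import Data.Product using (Σ; ∃; _×_; _,_; proj₁; proj₂)
open import Data.Sum using (inj₁; inj₂)
open import Data.Maybe using (Maybe; just; nothing; _<∣>_)
import Data.Maybe.Properties as MP
open import Data.Unit using (tt)
open import Data.Empty using (⊥; ⊥-elim)
open import Relation.Nullary using (¬_; Dec; yes; no; ¬?)
open import Relation.Nullary.Decidable using (toWitness; decidable-stable)
open import Relation.Binary.PropositionalEquality

0<½ : 0ℚ < ½
0<½ = toWitness {a? = 0ℚ <? ½} tt

0<1 : 0ℚ < 1ℚ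
0<1 = toWitness {a? = 0ℚ <? 1ℚ} tt

-1≤1 : - 1ℚ ≤ 1ℚ
-1≤1 = toWitness {a? = - 1ℚ ≤? 1ℚ} tt

x≤x+e : ∀ x {e} → 0ℚ ≤ e → x ≤ x + e
x≤x+e x e≥0 = subst₂ _≤_ (+-identityʳ x) refl (+-monoʳ-≤ x e≥0)

x<x+e : ∀ x {e} → 0ℚ < e → x < x + e
x<x+e x e>0 = subst₂ _<_ (+-identityʳ x) refl (+-monoʳ-< x e>0)

x-e≤x : ∀ x {e} → 0ℚ ≤ e → x - e ≤ x
x-e≤x x e≥0 = subst₂ _≤_ refl (+-identityʳ x) (+-monoʳ-≤ x (neg-antimono-≤ e≥0))

x-e<x : ∀ x {e} → 0ℚ < e → x - e < x
x-e<x x e>0 = subst₂ _<_ refl (+-identityʳ x) (+-monoʳ-< x (neg-antimono-< e>0))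

0≤v-u : ∀ {u v} → u ≤ v → 0ℚ ≤ v - u
0≤v-u {u} le = subst₂ _≤_ (+-inverseʳ u) refl (+-monoˡ-≤ (- u) le)

0<v-u : ∀ {u v} → u < v → 0ℚ < v - u
0<v-u {u} lt = subst₂ _<_ (+-inverseʳ u) refl (+-monoˡ-< (- u) lt)

≤+⇒-≤ : ∀ {x y e} → x ≤ y + e → x - y ≤ e
≤+⇒-≤ {x} {y} {e} h =
  subst₂ _≤_ refl (solve 2 (λ y e → y :+ e :- y := e) refl y e) (+-monoˡ-≤ (- y) h)

-≤⇒≤+ : ∀ {x y e} → x - e ≤ y → x ≤ y + e
-≤⇒≤+ {x} {y} {e} h =
  subst₂ _≤_ (solve 2 (λ x e → x :- e :+ e := x) refl x e) refl (+-monoˡ-≤ e h)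

gap-below : ∀ {x y e z} → x ≤ y + e → e < x - z → z < y
gap-below {x} {y} {e} {z} h1 h2 = <-≤-trans
  (subst₂ _<_ (solve 2 (λ e z → e :+ (z :- e) := z) refl e z)
              (solve 3 (λ x z e → (x :- z) :+ (z :- e) := x :- e) refl x z e)
              (+-monoˡ-< (z - e) h2))
  (subst₂ _≤_ refl (solve 2 (λ y e → y :+ e :- e := y) refl y e) (+-monoˡ-≤ (- e) h1))

gap-above : ∀ {x y e z} → y ≤ x + e → e < z - x → y < z
gap-above {x} {y} {e} {z} h1 h2 =
  ≤-<-trans h1 (subst₂ _<_ refl (solve 2 (λ x z → x :+ (z :- x) := z) refl x z) (+-monoʳ-< x h2))

2^_ : ℕ → ℚ
2^ zero    = 1ℚ
2^ (suc k) = 2^ k + 2^ k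

0<2^ : ∀ k → 0ℚ < 2^ k
0<2^ zero    = 0<1
0<2^ (suc k) = +-mono-< (0<2^ k) (0<2^ k)

scale≤ : ∀ k {a b} → a ≤ b → 2^ k * a ≤ 2^ k * b
scale≤ k = *-monoˡ-≤-nonNeg (2^ k) {{nonNegative (<⇒≤ (0<2^ k))}}

half< : ∀ x → 0ℚ < x → ½ * x < x
half< x x>0 = subst₂ _<_ (+-identityʳ (½ * x)) halves (+-monoʳ-< (½ * x) ½x>0)
  where
  ½x>0 : 0ℚ < ½ * x
  ½x>0 = subst₂ _<_ (*-zeroʳ ½) refl (*-monoʳ-<-pos ½ {{positive 0<½}} x>0)
  halves : ½ * x + ½ * x ≡ x
  halves = trans (solve 2 (λ h x → h :* x :+ h :* x := x :* (h :+ h)) refl ½ x) (*-identityʳ x)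

0<2^- : ∀ n → 0ℚ < 2^- n
0<2^- zero    = 0<1
0<2^- (suc n) = subst₂ _<_ (*-zeroʳ ½) refl (*-monoʳ-<-pos ½ {{positive 0<½}} (0<2^- n))

0≤2^- : ∀ n → 0ℚ ≤ 2^- n
0≤2^- n = <⇒≤ (0<2^- n)

2^-suc≤ : ∀ n → 2^- (suc n) ≤ 2^- n
2^-suc≤ n = <⇒≤ (half< _ (0<2^- n))

2^-antitone : ∀ {m n} → m ℕ.≤ n → 2^- n ≤ 2^- m
2^-antitone {zero} {zero}  ℕ.z≤n       = ≤-refl
2^-antitone {zero} {suc n} ℕ.z≤n       = ≤-trans (2^-suc≤ n) (2^-antitone {zero} {n} ℕ.z≤n)
2^-antitone            (ℕ.s≤s m≤n) =
  *-monoˡ-≤-nonNeg ½ {{nonNegative (<⇒≤ 0<½)}} (2^-antitone m≤n)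

2^*2^- : ∀ k j → 2^ k * 2^- (k ℕ.+ j) ≡ 2^- j
2^*2^- zero    j = *-identityˡ (2^- j)
2^*2^- (suc k) j = begin
  (p + p) * (½ * x)  ≡⟨ solve 3 (λ p h x → (p :+ p) :* (h :* x) := p :* x :* (h :+ h)) refl p ½ x ⟩
  p * x * 1ℚ         ≡⟨ *-identityʳ (p * x) ⟩
  p * x              ≡⟨ 2^*2^- k j ⟩
  2^- j              ∎
  where
  open ≡-Reasoning
  p = 2^ k
  x = 2^- (k ℕ.+ j)

2^*2^-≡1 : ∀ k → 2^ k * 2^- k ≡ 1ℚ
2^*2^-≡1 k = trans (cong (λ n → 2^ k * 2^- n) (sym (ℕP.+-identityʳ k))) (2^*2^- k 0)

-- 2^n - 1 as a natural number, so that the unnormalised form of 2^- n is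
-- 1/(1 + 2^ℕ-1 n); the step is written so that 1 + 2^ℕ-1 (1 + n) is
-- definitionally 2 * (1 + 2^ℕ-1 n).
2^ℕ-1 : ℕ → ℕ
2^ℕ-1 zero    = zero
2^ℕ-1 (suc n) = 2^ℕ-1 n ℕ.+ suc (2^ℕ-1 n ℕ.+ 0)

2^-≃ : ∀ n → toℚᵘ (2^- n) U.≃ mkℚᵘ (+ 1) (2^ℕ-1 n)
2^-≃ zero    = U.*≡* refl
2^-≃ (suc n) = UP.≃-trans (toℚᵘ-homo-* ½ (2^- n)) (UP.*-congˡ {toℚᵘ ½} (2^-≃ n))

n≤2^ℕ-1 : ∀ n → n ℕ.≤ 2^ℕ-1 n
n≤2^ℕ-1 zero    = ℕ.z≤n
n≤2^ℕ-1 (suc n) =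
  ℕP.≤-trans (ℕ.s≤s (ℕP.≤-trans (n≤2^ℕ-1 n) (ℕP.≤-reflexive (sym (ℕP.+-identityʳ _)))))
             (ℕP.m≤n+m _ (2^ℕ-1 n))

-- Archimedean property: a positive rational (1+p)/(1+q) is at least 2^-q.
archimedean : ∀ d → 0ℚ < d → ∃ λ N → 2^- N ≤ d
archimedean (mkℚ +[1+ p ] q _) _ =
  q , toℚᵘ-cancel-≤ (UP.≤-respˡ-≃ (UP.≃-sym (2^-≃ q)) (U.*≤* cross))
  where
  cross : + 1 ℤ.* + suc q ℤ.≤ +[1+ p ] ℤ.* + suc (2^ℕ-1 q)
  cross rewrite ℤP.*-identityˡ (+ suc q) | sym (ℤP.pos-* (suc p) (suc (2^ℕ-1 q))) =
    ℤ.+≤+ (ℕP.≤-trans (ℕ.s≤s (n≤2^ℕ-1 q)) (ℕP.m≤n*m (suc (2^ℕ-1 q)) (suc p)))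
archimedean (mkℚ (+ 0)      _ _) (*<* (ℤ.+<+ ()))
archimedean (mkℚ ℤ.-[1+ _ ] _ _) (*<* ())

archimedean< : ∀ d → 0ℚ < d → ∃ λ N → 2^- N < d
archimedean< d d>0 with archimedean d d>0
... | N , le = suc N , <-≤-trans (half< _ (0<2^- N)) le

archimedean₂ : ∀ {d e} → 0ℚ < d → 0ℚ < e → ∃ λ N → (2^- N < d) × (2^- N < e)
archimedean₂ {d} {e} d>0 e>0 = combine (archimedean< d d>0) (archimedean< e e>0)
  where
  combine : (∃ λ N → 2^- N < d) → (∃ λ N → 2^- N < e) → ∃ λ N → (2^- N < d) × (2^- N < e)
  combine (N₁ , lt₁) (N₂ , lt₂) =
    N₁ ℕ.⊔ N₂ , ≤-<-trans (2^-antitone {N₁} {N₁ ℕ.⊔ N₂} (ℕP.m≤m⊔n N₁ N₂)) lt₁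
              , ≤-<-trans (2^-antitone {N₂} {N₁ ℕ.⊔ N₂} (ℕP.m≤n⊔m N₁ N₂)) lt₂

≤-from-approx : ∀ {x y} → (∀ N → x ≤ y + 2^- N) → x ≤ y
≤-from-approx {x} {y} approx = decidable-stable (x ≤? y) refuted
  where
  refuted : ¬ ¬ (x ≤ y)
  refuted x≰y = too-small (archimedean< (x - y) (0<v-u (≰⇒> x≰y)))
    where
    too-small : (∃ λ N → 2^- N < x - y) → ⊥
    too-small (N , small) = <-irrefl refl (<-≤-trans small (≤+⇒-≤ (approx N)))

clamp : ℚ → ℚ
clamp u = (u ⊔ (- 1ℚ)) ⊓ 1ℚ

clamp-mono : ∀ {u v} → u ≤ v → clamp u ≤ clamp v
clamp-mono {u} {v} le = ⊓-monoˡ-≤ 1ℚ {u ⊔ (- 1ℚ)} {v ⊔ (- 1ℚ)} (⊔-monoˡ-≤ (- 1ℚ) le)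

-1≤clamp : ∀ u → - 1ℚ ≤ clamp u
-1≤clamp u = ⊓-glb { - 1ℚ} {u ⊔ (- 1ℚ)} {1ℚ} (p≤q⊔p u (- 1ℚ)) -1≤1

clamp≤1 : ∀ u → clamp u ≤ 1ℚ
clamp≤1 u = p⊓q≤q (u ⊔ (- 1ℚ)) 1ℚ

clamp-lipschitz : ∀ {u v} → u ≤ v → clamp v ≤ clamp u + (v - u)
clamp-lipschitz {u} {v} u≤v = cut-above {v ⊔ (- 1ℚ)} {u ⊔ (- 1ℚ)} raise-below
  where
  e = v - u
  e≥0 : 0ℚ ≤ e
  e≥0 = 0≤v-u u≤v
  raise-below : v ⊔ (- 1ℚ) ≤ (u ⊔ (- 1ℚ)) + e
  raise-below = ⊔-lub
    (subst₂ _≤_ (solve 2 (λ u v → u :+ (v :- u) := v) refl u v) refl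
                (+-monoˡ-≤ e (p≤p⊔q u (- 1ℚ))))
    (≤-trans (p≤q⊔p u (- 1ℚ)) (x≤x+e _ e≥0))
  cut-above : ∀ {w w'} → w ≤ w' + e → w ⊓ 1ℚ ≤ (w' ⊓ 1ℚ) + e
  cut-above {w} {w'} h with ≤-total w' 1ℚ
  ... | inj₁ w'≤1 rewrite p≤q⇒p⊓q≡p w'≤1 = ≤-trans (p⊓q≤p w 1ℚ) h
  ... | inj₂ 1≤w' rewrite p≥q⇒p⊓q≡q 1≤w' = ≤-trans (p⊓q≤q w 1ℚ) (x≤x+e 1ℚ e≥0)

⊑-refl : ∀ a → a ⊑ a
⊑-refl a = ≤-refl , ≤-refl

⊑-trans : ∀ {a b d} → a ⊑ b → b ⊑ d → a ⊑ d
⊑-trans (p , q) (p' , q') = ≤-trans p p' , ≤-trans q' q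

chain-mono : ∀ x → IsChain x → ∀ {m n} → m ℕ.≤ n → x m ⊑ x n
chain-mono x ch {m} {zero}  ℕ.z≤n = ⊑-refl (x zero)
chain-mono x ch {m} {suc n} m≤n with ℕP.m≤n⇒m<n∨m≡n m≤n
... | inj₁ (ℕ.s≤s m≤n') = ⊑-trans {x m} {x n} {x (suc n)} (chain-mono x ch m≤n') (ch n)
... | inj₂ refl         = ⊑-refl (x (suc n))

ℓ-antitone : ∀ {a a'} → a ⊑ a' → ℓ a' ≤ ℓ a
ℓ-antitone (p , q) = +-mono-≤ q (neg-antimono-≤ p)

mag : IQ → ℚ
mag a = hi a ⊔ (- lo a)

mag-antitone : ∀ {a a'} → a ⊑ a' → mag a' ≤ mag a
mag-antitone (p , q) = ⊔-mono-≤ q (neg-antimono-≤ p)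

0≤mag : ∀ a → 0ℚ ≤ mag a
0≤mag a with ≤-total 0ℚ (hi a)
... | inj₁ 0≤h = ≤-trans 0≤h (p≤p⊔q (hi a) (- lo a))
... | inj₂ h≤0 = ≤-trans (neg-antimono-≤ (≤-trans (lo≤hi a) h≤0)) (p≤q⊔p (hi a) (- lo a))

widen : (a : IQ) (η : ℚ) → 0ℚ ≤ η → IQ
widen a η η≥0 =
  [ lo a - η , hi a + η ]⟨ ≤-trans (x-e≤x (lo a) η≥0) (≤-trans (lo≤hi a) (x≤x+e (hi a) η≥0)) ⟩

-- Strict containment implies way-below: a chain whose supremum contains a
-- cannot stay outside b without its supremum leaving a.
strict⇒≪ : ∀ {b a} → lo b < lo a → hi a < hi b → b ≪ a
strict⇒≪ {b} {a} lb<la ha<hb x ch s (ub , least) (la≤ls , hs≤ha) outside =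
  lower-never-reached (λ n → ≰⇒> (λ le → lower-reached (n , le)))
  where
  -- once lo b is reached, every hi (x n) stays above hi b, so s ⊑ [lo s, hi b]
  lower-reached : (∃ λ n₀ → lo b ≤ lo (x n₀)) → ⊥
  lower-reached (n₀ , lb≤) = <-irrefl refl (≤-<-trans (≤-trans (proj₂ s⊑u) hs≤ha) ha<hb)
    where
    above : ∀ n → hi b < hi (x n)
    above n with hi (x (n ℕ.⊔ n₀)) ≤? hi b
    ... | yes h = ⊥-elim (outside (n ℕ.⊔ n₀)
                  (≤-trans lb≤ (proj₁ (chain-mono x ch (ℕP.m≤n⊔m n n₀))) , h))
    ... | no h  = <-≤-trans (≰⇒> h) (proj₂ (chain-mono x ch (ℕP.m≤m⊔n n n₀)))
    u : IQ
    u = [ lo s , hi b ]⟨ ≤-trans (lo≤hi s) (<⇒≤ (≤-<-trans hs≤ha ha<hb)) ⟩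
    s⊑u : s ⊑ u
    s⊑u = least u (λ n → proj₁ (ub n) , <⇒≤ (above n))
  -- if lo b is never reached, s ⊑ [lo b, hi s]
  lower-never-reached : (∀ n → lo (x n) < lo b) → ⊥
  lower-never-reached below = <-irrefl refl (<-≤-trans (<-≤-trans lb<la la≤ls) (proj₁ s⊑u))
    where
    u : IQ
    u = [ lo b , hi s ]⟨ ≤-trans (<⇒≤ (<-≤-trans lb<la la≤ls)) (lo≤hi s) ⟩
    s⊑u : s ⊑ u
    s⊑u = least u (λ n → <⇒≤ (below n) , proj₂ (ub n))

widen-≪ : ∀ a {η} (η>0 : 0ℚ < η) → widen a η (<⇒≤ η>0) ≪ a
widen-≪ a {η} η>0 = strict⇒≪ {widen a η (<⇒≤ η>0)} {a} (x-e<x (lo a) η>0) (x<x+e (hi a) η>0)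

-- Conversely way-below implies strict containment, tested on the chain of
-- widenings of a by 2^-n, whose supremum is a.
≪⇒strict : ∀ {b a} → b ≪ a → (lo b < lo a) × (hi a < hi b)
≪⇒strict {b} {a} b≪a =
    decidable-stable (lo b <? lo a)
      (λ ¬< → inside (λ n b⊑ → ¬< (≤-<-trans (proj₁ b⊑) (x-e<x (lo a) (0<2^- n)))))
  , decidable-stable (hi a <? hi b)
      (λ ¬< → inside (λ n b⊑ → ¬< (<-≤-trans (x<x+e (hi a) (0<2^- n)) (proj₂ b⊑))))
  where
  xs : Seq
  xs n = widen a (2^- n) (0≤2^- n)
  ch : IsChain xs
  ch n = +-monoʳ-≤ (lo a) (neg-antimono-≤ (2^-suc≤ n)) , +-monoʳ-≤ (hi a) (2^-suc≤ n)
  ub : ∀ n → xs n ⊑ a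
  ub n = x-e≤x _ (0≤2^- n) , x≤x+e _ (0≤2^- n)
  least : (u : IQ) → (∀ n → xs n ⊑ u) → a ⊑ u
  least u h = ≤-from-approx (λ N → -≤⇒≤+ (proj₁ (h N))) , ≤-from-approx (λ N → proj₂ (h N))
  inside : ∃̃ λ n → b ⊑ xs n
  inside = b≪a xs ch a (ub , least) (⊑-refl a)

≪⇒⊑ : ∀ {b a} → b ≪ a → b ⊑ a
≪⇒⊑ {b} {a} b≪a = weaken (≪⇒strict {b} {a} b≪a)
  where
  weaken : (lo b < lo a) × (hi a < hi b) → b ⊑ a
  weaken (lo< , hi<) = <⇒≤ lo< , <⇒≤ hi<

≪-⊑-trans : ∀ {b a a'} → b ≪ a → a ⊑ a' → b ≪ a'
≪-⊑-trans {a = a} {a'} b≪a a⊑a' x ch s sup a'⊑s = b≪a x ch s sup (⊑-trans {a} {a'} {s} a⊑a' a'⊑s)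

record Lipschitz (k : ℕ) (φ : ℚ → ℚ) : Set where
  field
    mono : ∀ {u v} → u ≤ v → φ u ≤ φ v
    lip  : ∀ {u v} → u ≤ v → φ v ≤ φ u + 2^ k * (v - u)
open Lipschitz

lift : ∀ {k φ} → Lipschitz k φ → IQ → IQ
lift {φ = φ} L a = [ φ (lo a) , φ (hi a) ]⟨ mono L (lo≤hi a) ⟩

module _ {k : ℕ} {φ : ℚ → ℚ} (L : Lipschitz k φ) where

  lift-mono : ∀ {a a'} → a ⊑ a' → lift L a ⊑ lift L a'
  lift-mono (p , q) = mono L p , mono L q

  lift-length : ∀ a → ℓ (lift L a) ≤ 2^ k * ℓ a
  lift-length a = ≤+⇒-≤ (lip L (lo≤hi a))

  lift-mag : φ 0ℚ ≡ 0ℚ → ∀ a → mag (lift L a) ≤ 2^ k * mag a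
  lift-mag φ0 a = ⊔-lub (bound-hi (hi a) (p≤p⊔q (hi a) (- lo a)))
                        (bound-lo (lo a) (p≤q⊔p (hi a) (- lo a)))
    where
    open ≤-Reasoning
    m≥0 : 0ℚ ≤ 2^ k * mag a
    m≥0 = subst₂ _≤_ (*-zeroʳ (2^ k)) refl (scale≤ k (0≤mag a))
    bound-hi : ∀ u → u ≤ mag a → φ u ≤ 2^ k * mag a
    bound-hi u u≤m with ≤-total u 0ℚ
    ... | inj₁ u≤0 = ≤-trans (subst₂ _≤_ refl φ0 (mono L u≤0)) m≥0
    ... | inj₂ 0≤u = begin
      φ u                    ≤⟨ lip L 0≤u ⟩
      φ 0ℚ + 2^ k * (u - 0ℚ) ≡⟨ cong₂ _+_ φ0 (cong (_*_ (2^ k)) (+-identityʳ u)) ⟩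
      0ℚ + 2^ k * u          ≡⟨ +-identityˡ (2^ k * u) ⟩
      2^ k * u               ≤⟨ scale≤ k u≤m ⟩
      2^ k * mag a           ∎
    bound-lo : ∀ u → - u ≤ mag a → - φ u ≤ 2^ k * mag a
    bound-lo u -u≤m with ≤-total 0ℚ u
    ... | inj₁ 0≤u = ≤-trans (neg-antimono-≤ (subst₂ _≤_ φ0 refl (mono L 0≤u))) m≥0
    ... | inj₂ u≤0 = begin
      - φ u            ≡⟨ sym (+-identityˡ (- φ u)) ⟩
      0ℚ - φ u         ≤⟨ ≤+⇒-≤ {0ℚ} {φ u} (subst₂ _≤_ φ0 refl (lip L u≤0)) ⟩
      2^ k * (0ℚ - u)  ≡⟨ cong (_*_ (2^ k)) (+-identityˡ (- u)) ⟩
      2^ k * (- u)     ≤⟨ scale≤ k -u≤m ⟩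
      2^ k * mag a     ∎

  -- Interpolation: if b ≪ φ[a], then already b ≪ φ[c] for some c ≪ a,
  -- namely a widened by a margin that φ stretches to less than both gaps.
  lift-interpolate : ∀ {b a} → b ≪ lift L a → Σ IQ λ c → c ≪ a × b ≪ lift L c
  lift-interpolate {b} {a} b≪φa =
    c , widen-≪ a {η} (0<2^- (k ℕ.+ M)) , strict⇒≪ {b} {lift L c} lo-gap hi-gap
    where
    gaps = ≪⇒strict {b} {lift L a} b≪φa
    M = proj₁ (archimedean₂ (0<v-u (proj₁ gaps)) (0<v-u (proj₂ gaps)))
    small = proj₂ (archimedean₂ (0<v-u (proj₁ gaps)) (0<v-u (proj₂ gaps)))
    η = 2^- (k ℕ.+ M)
    η≥0 = 0≤2^- (k ℕ.+ M)
    c = widen a η η≥0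
    stretch : ∀ {u v} → u ≤ v → v - u ≡ η → φ v ≤ φ u + 2^- M
    stretch {u} {v} u≤v d =
      subst₂ _≤_ refl (cong (_+_ (φ u)) (trans (cong (_*_ (2^ k)) d) (2^*2^- k M))) (lip L u≤v)
    lo-gap : lo b < φ (lo a - η)
    lo-gap = gap-below (stretch (x-e≤x (lo a) η≥0) (solve 2 (λ l η → l :- (l :- η) := η) refl (lo a) η))
                       (proj₁ small)
    hi-gap : φ (hi a + η) < hi b
    hi-gap = gap-above (stretch (x≤x+e (hi a) η≥0) (solve 2 (λ h η → h :+ η :- h := η) refl (hi a) η))
                       (proj₂ small)

clampScale : ℕ → ℚ → ℚ
clampScale k u = clamp (2^ k * u)

clampScale-lipschitz : ∀ k → Lipschitz k (clampScale k)
clampScale-lipschitz k = record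
  { mono = λ le → clamp-mono (scale≤ k le)
  ; lip  = λ {u} {v} le → subst₂ _≤_ refl
             (cong (_+_ (clampScale k u)) (solve 3 (λ s u v → s :* v :- s :* u := s :* (v :- u)) refl (2^ k) u v))
             (clamp-lipschitz (scale≤ k le))
  }

clampScale-0 : ∀ k → clampScale k 0ℚ ≡ 0ℚ
clampScale-0 k = cong clamp (*-zeroʳ (2^ k))

clampScaleI : ℕ → IQ → IQ
clampScaleI k = lift (clampScale-lipschitz k)

I1 : IQ
I1 = [ - 1ℚ , 1ℚ ]⟨ -1≤1 ⟩

stage : Maybe ℕ → IQ → IQ
stage nothing  _ = I1
stage (just k) a = clampScaleI k a

I1⊑stage : ∀ mk a → I1 ⊑ stage mk a
I1⊑stage nothing  a = ⊑-refl I1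
I1⊑stage (just k) a = -1≤clamp (2^ k * lo a) , clamp≤1 (2^ k * hi a)

stage-interpolate : ∀ mk {b a} → b ≪ stage mk a → Σ IQ λ c → c ≪ a × b ≪ stage mk c
stage-interpolate nothing  {b} {a} b≪I1 = widen a 1ℚ (<⇒≤ 0<1) , widen-≪ a 0<1 , b≪I1
stage-interpolate (just k) {b} {a} b≪φa = lift-interpolate (clampScale-lipschitz k) {b} {a} b≪φa

dist-to-origin : ∀ z a → lo z ≡ 0ℚ → hi z ≡ 0ℚ → hi (absI (z ⊕ (⊖ a))) ≡ mag a
dist-to-origin z a lz≡0 hz≡0 = trans (absI-hi (z ⊕ (⊖ a))) (cong₂ _⊔_ lower upper)
  where
  absI-hi : ∀ d → hi (absI d) ≡ (- lo d) ⊔ hi d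
  absI-hi d with 0ℚ ≤? lo d
  ... | yes 0≤l = sym (p≤q⇒p⊔q≡q (≤-trans (neg-antimono-≤ 0≤l) (≤-trans 0≤l (lo≤hi d))))
  ... | no _ with hi d ≤? 0ℚ
  ...   | yes h≤0 = sym (p≥q⇒p⊔q≡p (≤-trans h≤0 (neg-antimono-≤ (≤-trans (lo≤hi d) h≤0))))
  ...   | no _    = refl
  lower : - (lo z + - hi a) ≡ hi a
  lower rewrite lz≡0 = solve 1 (λ h → :- (con 0ℚ :+ :- h) := h) refl (hi a)
  upper : hi z + - lo a ≡ - lo a
  upper rewrite hz≡0 = +-identityˡ (- lo a)

-- Rescaling a bound on |0 - y| through a 2^k-Lipschitz map.
scale-bound : ∀ k j e A A' → - 2^- (k ℕ.+ j) ≤ e + - A → A' ≤ 2^ k * A → - 2^- j ≤ 2^ k * e + - A'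
scale-bound k j e A A' h A'≤ =
  ≤-trans (subst₂ _≤_ lhs rhs (scale≤ k h)) (+-monoʳ-≤ (2^ k * e) (neg-antimono-≤ A'≤))
  where
  lhs : 2^ k * (- 2^- (k ℕ.+ j)) ≡ - 2^- j
  lhs = trans (sym (neg-distribʳ-* (2^ k) (2^- (k ℕ.+ j)))) (cong -_ (2^*2^- k j))
  rhs : 2^ k * (e + - A) ≡ 2^ k * e + - (2^ k * A)
  rhs = solve 3 (λ s x m → s :* (x :+ :- m) := s :* x :+ :- (s :* m)) refl (2^ k) e A

approx-mono : ∀ (y : ℝ) {m n} → m ℕ.≤ n → seq (ir y) m ⊑ seq (ir y) n
approx-mono y = chain-mono (seq (ir y)) (chain (ir y))

ratℝ : ℚ → ℝ
ratℝ q = record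
  { ir    = record { seq = ratˢ q ; chain = λ _ → ⊑-refl ⟦ q ⟧ }
  ; total = λ k none → none 0 (subst₂ _≤_ (sym (+-inverseʳ q)) refl (0≤2^- k)) }

<∣>-nothing : ∀ {A : Set} (x y : Maybe A) → (x <∣> y) ≡ nothing → x ≡ nothing × y ≡ nothing
<∣>-nothing nothing  y eq = refl , eq
<∣>-nothing (just _) y ()

module Search {P : ℕ → Set} (P? : (n : ℕ) → Dec (P n)) where

  witnessAt : ℕ → Maybe ℕ
  witnessAt n with P? n
  ... | yes _ = just n
  ... | no _  = nothing

  witnessAt-sound : ∀ {n k} → witnessAt n ≡ just k → P k
  witnessAt-sound {n} eq with P? n
  witnessAt-sound {n} refl | yes p = p
  witnessAt-sound {n} ()   | no _

  witnessAt-none : ∀ {n} → witnessAt n ≡ nothing → ¬ P n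
  witnessAt-none {n} eq with P? n
  witnessAt-none {n} ()   | yes _
  witnessAt-none {n} refl | no ¬p = ¬p

  search : ℕ → Maybe ℕ
  search zero    = witnessAt zero
  search (suc n) = search n <∣> witnessAt (suc n)

  search-step : ∀ {n k} → search n ≡ just k → search (suc n) ≡ just k
  search-step eq rewrite eq = refl

  search-mono : ∀ {m n k} → m ℕ.≤ n → search m ≡ just k → search n ≡ just k
  search-mono {m} {zero}  ℕ.z≤n eq = eq
  search-mono {m} {suc n} m≤n eq with ℕP.m≤n⇒m<n∨m≡n m≤n
  ... | inj₁ (ℕ.s≤s m≤n') = search-step {n} (search-mono m≤n' eq)
  ... | inj₂ refl         = eq

  search-sound : ∀ n {k} → search n ≡ just k → P k
  search-sound zero    eq = witnessAt-sound eq
  search-sound (suc n) eq with search n in found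
  ... | just _  = search-sound n (trans found eq)
  ... | nothing = witnessAt-sound eq

  search-none : ∀ n → search n ≡ nothing → ∀ k → k ℕ.≤ n → ¬ P k
  search-none zero    eq .zero ℕ.z≤n = witnessAt-none eq
  search-none (suc n) eq k k≤n with <∣>-nothing (search n) (witnessAt (suc n)) eq | ℕP.m≤n⇒m<n∨m≡n k≤n
  ... | none≤n , _    | inj₁ (ℕ.s≤s k≤n') = search-none n none≤n k k≤n'
  ... | _ , none-here | inj₂ refl          = witnessAt-none none-here

  search-complete : ∀ k → P k → ∃ λ j → search k ≡ just j
  search-complete k pk with search k in found
  ... | just j  = j , refl
  ... | nothing = ⊥-elim (search-none k found k ℕP.≤-refl pk)

  search-unique : ∀ {m n a b} → search m ≡ just a → search n ≡ just b → a ≡ b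
  search-unique {m} {n} ea eb = MP.just-injective
    (trans (sym (search-mono (ℕP.m≤m⊔n m n) ea)) (search-mono (ℕP.m≤n⊔m m n) eb))

  search-least : ∀ {n k} → search n ≡ just k → search k ≡ just k
  search-least {n} {k} found with search-complete k (search-sound n found)
  ... | j , found-k = subst (λ i → search k ≡ just i) (search-unique {k} {n} found-k found) found-k

module Counterexample {P : ℕ → Set} (P? : (n : ℕ) → Dec (P n)) (¬¬∃ : ¬ ¬ (∃ λ n → P n)) where
  open Search P?

  -- Stages grow along the search: [-1,1] ⊑ clamp(2^k · _), and k never changes once found.
  stage-search-mono : ∀ {m n a a'} → m ℕ.≤ n → a ⊑ a' → stage (search m) a ⊑ stage (search n) a'
  stage-search-mono {m} {n} {a} {a'} m≤n a⊑a' with search m in found-m | search n in found-n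
  ... | nothing | mk      = I1⊑stage mk a'
  ... | just k  | nothing with () ← trans (sym (search-mono m≤n found-m)) found-n
  ... | just k  | just k' rewrite search-unique {m} {n} found-m found-n =
    lift-mono (clampScale-lipschitz k') {a} {a'} a⊑a'

  Fseq : ℝ → Seq
  Fseq y n = stage (search n) (seq (ir y) n)

  Fseq-found : ∀ {m k} y → search m ≡ just k → Fseq y m ≡ clampScaleI k (seq (ir y) m)
  Fseq-found y found rewrite found = refl

  F-chain : ∀ y → IsChain (Fseq y)
  F-chain y n = stage-search-mono (ℕP.n≤1+n n) (chain (ir y) n)

  -- Once the witness k is found, F(y) has length at most 2^k times that of y.
  F-total : ∀ y → IsTotal record { seq = Fseq y ; chain = F-chain y }
  F-total y j none = ¬¬∃ λ (k₀ , pk₀) → shrinks-after k₀ (search-complete k₀ pk₀)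
    where
    shrinks-after : ∀ k₀ → (∃ λ k → search k₀ ≡ just k) → ⊥
    shrinks-after k₀ (k , found) = total y (k ℕ.+ j) λ n short → none (n ℕ.⊔ k₀) (shrinks n short)
      where
      open ≤-Reasoning
      shrinks : ∀ n → ℓ (seq (ir y) n) ≤ 2^- (k ℕ.+ j) → ℓ (Fseq y (n ℕ.⊔ k₀)) ≤ 2^- j
      shrinks n short = begin
        ℓ (Fseq y n')          ≡⟨ cong ℓ (Fseq-found y (search-mono (ℕP.m≤n⊔m n k₀) found)) ⟩
        ℓ (clampScaleI k yₙ')  ≤⟨ lift-length (clampScale-lipschitz k) yₙ' ⟩
        2^ k * ℓ yₙ'           ≤⟨ scale≤ k (ℓ-antitone {yₙ} {yₙ'} (approx-mono y (ℕP.m≤m⊔n n k₀))) ⟩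
        2^ k * ℓ yₙ            ≤⟨ scale≤ k short ⟩
        2^ k * 2^- (k ℕ.+ j)   ≡⟨ 2^*2^- k j ⟩
        2^- j                  ∎
        where
        n' = n ℕ.⊔ k₀
        yₙ = seq (ir y) n
        yₙ' = seq (ir y) n'

  F : ℝ → ℝ
  F y = record { ir = record { seq = Fseq y ; chain = F-chain y } ; total = F-total y }

  -- b ≪ F(x)ₙ interpolates through some c ≪ xₙ; x ⊑ y yields c ≪ yₘ, hence
  -- b ≪ F(y) at stage n ⊔ m.
  F-⊑ : ∀ x y → ir x ⊑ᴵᴿ ir y → ir (F x) ⊑ᴵᴿ ir (F y)
  F-⊑ x y x⊑y b n b≪Fxn none with stage-interpolate (search n) {b} {seq (ir x) n} b≪Fxn
  ... | c , c≪xn , b≪stage-c = x⊑y c n c≪xn λ m c≪ym → none (n ℕ.⊔ m)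
    (≪-⊑-trans {b} {stage (search n) c} {Fseq y (n ℕ.⊔ m)} b≪stage-c
      (stage-search-mono {n} {n ℕ.⊔ m} {c} {seq (ir y) (n ℕ.⊔ m)} (ℕP.m≤m⊔n n m)
        (⊑-trans {c} {seq (ir y) m} {seq (ir y) (n ℕ.⊔ m)} (≪⇒⊑ {c} {seq (ir y) m} c≪ym)
                 (approx-mono y (ℕP.m≤n⊔m n m)))))

  F-respects : Respects≈ F
  F-respects x y (x⊑y , y⊑x) = F-⊑ x y x⊑y , F-⊑ y x y⊑x

  F-dist-found : ∀ {m k} y → search m ≡ just k →
                 hi (absI (Fseq 0ℝ m ⊕ (⊖ Fseq y m))) ≡ mag (clampScaleI k (seq (ir y) m))
  F-dist-found {m} {k} y found rewrite found =
    dist-to-origin (clampScaleI k ⟦ 0ℚ ⟧) _ (clampScale-0 k) (clampScale-0 k)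

  ε-bound : Maybe ℕ → ℕ → ℚ∞
  ε-bound nothing  n = ∞
  ε-bound (just k) n = fin (2^ k * 2^- n)

  ε : ℕ → ℚ∞
  ε n = ε-bound (search n) n

  -- Once the witness k is found at stage n, a bound |0 - yₘ| ≤ 2^-n up to
  -- 2^-(k+j) becomes |F(0) - F(y)| ≤ 2^k·2^-n up to 2^-j at stage m ⊔ n.
  F-modulus : ∀ n (y : ℝ) → dist≤ 0ℝ y (2^- n) → dist≤∞ (F 0ℝ) (F y) (ε n)
  F-modulus n y close with search n in found
  ... | nothing = tt
  ... | just k  = λ j none → close (k ℕ.+ j) λ m h → none (m ℕ.⊔ n) (rescaled j m h)
    where
    rescaled : ∀ j m → - 2^- (k ℕ.+ j) ≤ 2^- n + - hi (absI (⟦ 0ℚ ⟧ ⊕ (⊖ seq (ir y) m))) →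
               - 2^- j ≤ 2^ k * 2^- n + - hi (absI (Fseq 0ℝ (m ℕ.⊔ n) ⊕ (⊖ Fseq y (m ℕ.⊔ n))))
    rescaled j m h = subst (λ z → - 2^- j ≤ 2^ k * 2^- n + - z)
      (sym (F-dist-found y (search-mono (ℕP.m≤n⊔m m n) found)))
      (scale-bound k j (2^- n) _ _ close-at-m mag-shrinks)
      where
      yₘ = seq (ir y) m
      yₘ' = seq (ir y) (m ℕ.⊔ n)
      close-at-m : - 2^- (k ℕ.+ j) ≤ 2^- n + - mag yₘ
      close-at-m = subst (λ z → - 2^- (k ℕ.+ j) ≤ 2^- n + - z) (dist-to-origin ⟦ 0ℚ ⟧ yₘ refl refl) h
      mag-shrinks : mag (clampScaleI k yₘ') ≤ 2^ k * mag yₘ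
      mag-shrinks = ≤-trans (lift-mag (clampScale-lipschitz k) (clampScale-0 k) yₘ')
                            (scale≤ k (mag-antitone {yₘ} {yₘ'} (approx-mono y (ℕP.m≤m⊔n m n))))

  ε-nonneg : ∀ n → NonNeg∞ (ε n)
  ε-nonneg n with search n
  ... | nothing = tt
  ... | just k  = subst₂ _≤_ (*-zeroʳ (2^ k)) refl (scale≤ k (0≤2^- n))

  ε-decreasing : ∀ n → ε (suc n) ≤∞ ε n
  ε-decreasing n = compare (search n) (search (suc n)) refl refl
    where
    compare : ∀ mk mk' → search n ≡ mk → search (suc n) ≡ mk' → ε-bound mk' (suc n) ≤∞ ε-bound mk n
    compare nothing  nothing   _  _  = tt
    compare nothing  (just _)  _  _  = tt
    compare (just k) nothing   eq eq' with () ← trans (sym (search-step {n} eq)) eq'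
    compare (just k) (just k') eq eq' rewrite search-unique {suc n} {n} eq' eq = scale≤ k (2^-suc≤ n)

  -- Weakly the witness is found at some stage k₀; past k₀ + k + N we have εₙ ≤ 2^-N ≤ e.
  ε-null : (e : ℚ) → 0ℚ < e → ∃̃ λ (m : ℕ) → (n : ℕ) → m ℕ.≤ n → ε n ≤∞ fin e
  ε-null e e>0 none =
    ¬¬∃ λ (k₀ , pk₀) → eventually-small k₀ (search-complete k₀ pk₀) (archimedean e e>0)
    where
    eventually-small : ∀ k₀ → (∃ λ k → search k₀ ≡ just k) → (∃ λ N → 2^- N ≤ e) → ⊥
    eventually-small k₀ (k , found) (N , 2^-N≤e) = none (k₀ ℕ.+ (k ℕ.+ N)) λ n m≤n →
      subst (λ mk → ε-bound mk n ≤∞ fin e)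
            (sym (search-mono (ℕP.≤-trans (ℕP.m≤m+n k₀ _) m≤n) found))
        (≤-trans (scale≤ k (2^-antitone (ℕP.≤-trans (ℕP.m≤n+m (k ℕ.+ N) k₀) m≤n)))
                 (subst₂ _≤_ (sym (2^*2^- k N)) refl 2^-N≤e))

  F-nondiscontinuous : NonDiscontinuousAt F 0ℝ
  F-nondiscontinuous = 2^-_ , ε , 0<2^- , F-modulus , ε-nonneg , ε-decreasing , ε-null

  far-apart : ∀ j → search j ≡ just j → ∀ m →
              ¬ (- 2^- 2 ≤ ½ + - hi (absI (Fseq 0ℝ m ⊕ (⊖ Fseq (ratℝ (2^- j)) m))))
  far-apart j found-j m with search m in found-m
  ... | nothing = toWitness {a? = ¬? (- 2^- 2 ≤? (½ + - hi (absI (I1 ⊕ (⊖ I1)))))} tt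
  ... | just k rewrite search-unique {m} {j} found-m found-j =
    subst (λ z → ¬ (- 2^- 2 ≤ ½ + - z)) (sym distance) clamp1-far
    where
    clamp1-far : ¬ (- 2^- 2 ≤ ½ + - (clamp 1ℚ ⊔ - clamp 1ℚ))
    clamp1-far = toWitness {a? = ¬? (- 2^- 2 ≤? (½ + - (clamp 1ℚ ⊔ - clamp 1ℚ)))} tt
    distance : hi (absI (clampScaleI j ⟦ 0ℚ ⟧ ⊕ (⊖ clampScaleI j ⟦ 2^- j ⟧)))
             ≡ clamp 1ℚ ⊔ - clamp 1ℚ
    distance = trans (dist-to-origin _ (clampScaleI j ⟦ 2^- j ⟧) (clampScale-0 j) (clampScale-0 j))
                     (cong (λ z → clamp z ⊔ - clamp z) (2^*2^-≡1 j))

  rat-close-to-0 : ∀ {t δ} → 0ℚ ≤ t → t ≤ δ → dist≤ 0ℝ (ratℝ t) δ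
  rat-close-to-0 {t} {δ} 0≤t t≤δ i none = none 0
    (subst (λ z → - 2^- i ≤ δ + - z) (sym (dist-to-origin ⟦ 0ℚ ⟧ ⟦ t ⟧ refl refl))
      (≤-trans (neg-antimono-≤ (0≤2^- i))
               (0≤v-u (⊔-lub t≤δ (≤-trans (neg-antimono-≤ 0≤t) (≤-trans 0≤t t≤δ))))))

  -- A modulus δ for ε = ½ forces the search up to N (2^-N ≤ δ) to succeed:
  -- a least witness j > N would put F(2^-j) at distance 1 from F(0).
  witness-from-modulus :
    Σ ℚ (λ δ → (0ℚ < δ) × ((y : ℝ) → dist≤ 0ℝ y δ → dist≤ (F 0ℝ) (F y) ½)) → ∃ λ n → P n
  witness-from-modulus (δ , δ>0 , modulus) with archimedean δ δ>0
  ... | N , 2^-N≤δ with search N in found-N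
  ...   | just k  = k , search-sound N found-N
  ...   | nothing = ⊥-elim (¬¬∃ λ (k₀ , pk₀) → refute {k₀} (proj₂ (search-complete k₀ pk₀)))
    where
    refute : ∀ {k₀ j} → search k₀ ≡ just j → ⊥
    refute {k₀} {j} found = modulus (ratℝ (2^- j)) close 2 (far-apart j (search-least {k₀} {j} found))
      where
      N<j : N ℕ.< j
      N<j = ℕP.≰⇒> (λ j≤N → search-none N found-N j j≤N (search-sound k₀ found))
      close : dist≤ 0ℝ (ratℝ (2^- j)) δ
      close = rat-close-to-0 (0≤2^- j) (≤-trans (2^-antitone (ℕP.<⇒≤ N<j)) 2^-N≤δ)

lemma8p13 : ((f : ℝ → ℝ) → Respects≈ f →
    NonDiscontinuousAt f 0ℝ → ContinuousAt f 0ℝ) →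
    MarkovPrinciple
lemma8p13 hyp P P? ¬¬∃ = witness-from-modulus (hyp F F-respects F-nondiscontinuous ½ 0<½)
  where open Counterexample P? ¬¬∃
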